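{- For $N\in\mathbb{N}$, \begin{equation*} \sum_{n=1}^{N}\genfrac{[}{]}{0pt}{}{N}{n}\frac{(q)_{n-1}(q)_n(zq)_{N-n}(zq)^n}{(zq)_n(zq)_{N}(1-cq^n)}=z\sum_{n=1}^{N}\genfrac{[}{]}{0pt}{}{N}{n}\frac{(zq/c)_{n-1}(q)_n(cq)_{N-n}c^{n-1}q^n}{(zq)_n(cq)_{N}(1-zq^n)}. \end{equation*}
   Context: Here $|q|<1$, $(A)_n=(A;q)_n=(1-A)(1-Aq)\cdots(1-Aq^{n-1})$ with $(A)_0=1$, and $\genfrac{[}{]}{0pt}{}{N}{n}=\frac{(q;q)_N}{(q;q)_n(q;q)_{N-n}}$ is the $q$-binomial coefficient; $z,c$ are such that no denominator vanishes. -}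

module Defs where

open import Level using (Level; _⊔_) renaming (suc to lsuc)
open import Data.Nat using (ℕ; zero; suc; _∸_)
open import Relation.Nullary using (¬_)
open import Algebra.Bundles using (CommutativeRing)

-- A field: a commutative ring with 0 ≠ 1 and a (total) inverse operation
-- which is a multiplicative inverse on every nonzero element.
-- (The value of 0⁻¹ is irrelevant; it is never used under the hypotheses.)
-- ℂ is an instance.
record Field (a ℓ : Level) : Set (lsuc (a ⊔ ℓ)) where
  field
    commutativeRing : CommutativeRing a ℓ
  open CommutativeRing commutativeRing public
  field
    _⁻¹     : Carrier → Carrier
    0≉1     : ¬ (0# ≈ 1#)
    ⁻¹-inverseʳ : ∀ x → ¬ (x ≈ 0#) → x * (x ⁻¹) ≈ 1#

module FieldDefs {a ℓ : Level} (F : Field a ℓ) where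
  open Field F

  infixl 7 _/_
  infixr 8 _^_

  _/_ : Carrier → Carrier → Carrier
  x / y = x * (y ⁻¹)

  _^_ : Carrier → ℕ → Carrier
  x ^ zero  = 1#
  x ^ suc n = x * (x ^ n)

  poch : Carrier → Carrier → ℕ → Carrier
  poch A q zero    = 1#
  poch A q (suc n) = poch A q n * (1# - A * (q ^ n))

  qbinom : Carrier → ℕ → ℕ → Carrier
  qbinom q N n = poch q q N / (poch q q n * poch q q (N ∸ n))

  sum1 : ℕ → (ℕ → Carrier) → Carrier
  sum1 zero    f = 0#
  sum1 (suc N) f = sum1 N f + f (suc N)

module Submission where

-- Up to the prefactors (q;q)_N/(zq;q)_N and (q;q)_N/(cq;q)_N,
-- each side is a convolution Σ_{n=1}^{N} α_n w_{N−n} of explicit coefficients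
-- α with weights w_m = (bq;q)_m/(q;q)_m (b = z on the left, b = c on the right).
-- The weights satisfy a first-order recurrence in m; using it, together with a
-- contiguity relation of the coefficients and a telescoping sum, each
-- convolution L_K, R_K obeys a first-order inhomogeneous recurrence in K.  The
-- two recurrences have the same homogeneous part and matching forcing terms, so
-- (cq;q)_K L_K = z (zq;q)_K R_K follows by induction on K; at K = N this is the
-- corollary after clearing denominators.

open import Defs
open import Level using (Level)
open import Data.Nat using (ℕ; _≤_; _∸_)
open import Data.Product using (_×_)
open import Relation.Nullary using (¬_)

open import Algebra.Bundles using (CommutativeRing)
open import Data.Nat as ℕ using (zero; suc; z≤n; s≤s)
import Data.Nat.Properties as ℕP
open import Data.Integer as ℤ using (ℤ; +_; -[1+_]; _⊖_)
import Data.Integer.Properties as ℤP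
open import Data.Maybe using (Maybe; just; nothing)
open import Data.Product using (proj₁; proj₂)
open import Relation.Nullary using (yes; no)
import Relation.Binary.PropositionalEquality as P
open import Algebra.Solver.Ring.AlmostCommutativeRing

-- Every commutative ring R receives a ring homomorphism from ℤ,
-- n ↦ n · 1.  With it, the standard ring solver normalises polynomial
-- identities over R with integer coefficients (so subtraction is allowed).
module IntegerCoefficientSolver {a ℓ : Level} (R : CommutativeRing a ℓ) where
  open CommutativeRing R
  open import Algebra.Properties.Ring ring
  open import Algebra.Properties.Semiring.Mult.TCOptimised semiring
    using (×-homo-+; ×1-homo-*; 1+×) renaming (_×_ to _·_)
  open import Relation.Binary.Reasoning.Setoid setoid

  -- The image n · 1# of a natural number; 1 · 1# is 1# by definition, which
  -- the solver needs for its constant 1.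
  natural : ℕ → Carrier
  natural n = n · 1#

  integer : ℤ → Carrier
  integer (+ n)    = natural n
  integer -[1+ n ] = - natural (suc n)

  shift-difference : ∀ x y → (1# + x) - (1# + y) ≈ x - y
  shift-difference x y = begin
    (1# + x) + - (1# + y)   ≈⟨ +-congˡ (sym (-‿+-comm 1# y)) ⟩
    (1# + x) + (- 1# + - y) ≈⟨ +-assoc _ _ _ ⟩
    1# + (x + (- 1# + - y)) ≈⟨ +-congˡ (sym (+-assoc _ _ _)) ⟩
    1# + ((x + - 1#) + - y) ≈⟨ +-congˡ (+-congʳ (+-comm _ _)) ⟩
    1# + ((- 1# + x) + - y) ≈⟨ +-congˡ (+-assoc _ _ _) ⟩
    1# + (- 1# + (x + - y)) ≈⟨ sym (+-assoc _ _ _) ⟩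
    (1# + - 1#) + (x + - y) ≈⟨ +-congʳ (-‿inverseʳ 1#) ⟩
    0# + (x + - y)          ≈⟨ +-identityˡ _ ⟩
    x - y                   ∎

  integer-⊖ : ∀ m n → integer (m ⊖ n) ≈ natural m - natural n
  integer-⊖ m zero = begin
    integer (m ⊖ 0)   ≡⟨ P.cong integer (ℤP.⊖-≥ {m} {0} z≤n) ⟩
    natural m         ≈⟨ sym (+-identityʳ _) ⟩
    natural m + 0#    ≈⟨ +-congˡ (sym -0#≈0#) ⟩
    natural m - 0#    ∎
  integer-⊖ zero (suc n) = sym (+-identityˡ _)
  integer-⊖ (suc m) (suc n) = begin
    integer (suc m ⊖ suc n)           ≡⟨ P.cong integer (ℤP.[1+m]⊖[1+n]≡m⊖n m n) ⟩
    integer (m ⊖ n)                   ≈⟨ integer-⊖ m n ⟩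
    natural m - natural n             ≈⟨ sym (shift-difference _ _) ⟩
    (1# + natural m) - (1# + natural n) ≈⟨ sym (+-cong (1+× m 1#) (-‿cong (1+× n 1#))) ⟩
    natural (suc m) - natural (suc n) ∎

  integer-+ : ∀ i j → integer (i ℤ.+ j) ≈ integer i + integer j
  integer-+ (+ m)    (+ n)    = ×-homo-+ 1# m n
  integer-+ (+ m)    -[1+ n ] = integer-⊖ m (suc n)
  integer-+ -[1+ m ] (+ n)    = trans (integer-⊖ n (suc m)) (+-comm _ _)
  integer-+ -[1+ m ] -[1+ n ] = begin
    - natural (suc (suc (m ℕ.+ n)))   ≡⟨ P.cong (λ k → - natural (suc k)) (P.sym (ℕP.+-suc m n)) ⟩
    - natural (suc m ℕ.+ suc n)       ≈⟨ -‿cong (×-homo-+ 1# (suc m) (suc n)) ⟩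
    - (natural (suc m) + natural (suc n)) ≈⟨ sym (-‿+-comm _ _) ⟩
    - natural (suc m) + - natural (suc n) ∎

  integer-neg : ∀ i → integer (ℤ.- i) ≈ - integer i
  integer-neg (+ zero)  = sym -0#≈0#
  integer-neg (+ suc n) = refl
  integer-neg -[1+ n ]  = sym (-‿involutive _)

  integer-*-natural : ∀ m j → integer (+ m ℤ.* j) ≈ natural m * integer j
  integer-*-natural m (+ n) = begin
    integer (+ m ℤ.* + n)   ≡⟨ P.cong integer (P.sym (ℤP.pos-* m n)) ⟩
    natural (m ℕ.* n)       ≈⟨ ×1-homo-* m n ⟩
    natural m * natural n   ∎
  integer-*-natural m -[1+ n ] = begin
    integer (+ m ℤ.* -[1+ n ])         ≡⟨ P.cong integer (P.sym (ℤP.neg-distribʳ-* (+ m) (+ suc n))) ⟩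
    integer (ℤ.- (+ m ℤ.* + suc n))    ≈⟨ integer-neg (+ m ℤ.* + suc n) ⟩
    - integer (+ m ℤ.* + suc n)        ≈⟨ -‿cong (integer-*-natural m (+ suc n)) ⟩
    - (natural m * natural (suc n))    ≈⟨ -‿distribʳ-* _ _ ⟩
    natural m * - natural (suc n)      ∎

  integer-* : ∀ i j → integer (i ℤ.* j) ≈ integer i * integer j
  integer-* (+ m)    j = integer-*-natural m j
  integer-* -[1+ m ] j = begin
    integer (-[1+ m ] ℤ.* j)           ≡⟨ P.cong integer (P.sym (ℤP.neg-distribˡ-* (+ suc m) j)) ⟩
    integer (ℤ.- (+ suc m ℤ.* j))      ≈⟨ integer-neg (+ suc m ℤ.* j) ⟩
    - integer (+ suc m ℤ.* j)          ≈⟨ -‿cong (integer-*-natural (suc m) j) ⟩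
    - (natural (suc m) * integer j)    ≈⟨ -‿distribˡ-* _ _ ⟩
    - natural (suc m) * integer j      ∎

  almostCommutativeRing : AlmostCommutativeRing a ℓ
  almostCommutativeRing = fromCommutativeRing R

  integer-morphism : ℤ.+-*-rawRing -Raw-AlmostCommutative⟶ almostCommutativeRing
  integer-morphism = record
    { ⟦_⟧ = integer ; +-homo = integer-+ ; *-homo = integer-* ; -‿homo = integer-neg
    ; 0-homo = refl ; 1-homo = refl }

  coefficients≟ : ∀ i j → Maybe (integer i ≈ integer j)
  coefficients≟ i j with i ℤ.≟ j
  ... | yes P.refl = just refl
  ... | no _       = nothing

  open import Algebra.Solver.Ring ℤ.+-*-rawRing almostCommutativeRing integer-morphism coefficients≟ public

module FieldFacts {a ℓ : Level} (F : Field a ℓ) where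
  open Field F
  open FieldDefs F
  open IntegerCoefficientSolver commutativeRing
  open import Algebra.Properties.Ring ring using (x[y-z]≈xy-xz)
  open import Relation.Binary.Reasoning.Setoid setoid

  𝟙 : ∀ {n} → Polynomial n
  𝟙 = con (+ 1)

  Nonzero : Carrier → Set ℓ
  Nonzero x = ¬ (x ≈ 0#)

  nonzero-resp : ∀ {x y} → x ≈ y → Nonzero y → Nonzero x
  nonzero-resp x≈y y≉0 x≈0 = y≉0 (trans (sym x≈y) x≈0)

  one-nonzero : Nonzero 1#
  one-nonzero 1≈0 = 0≉1 (sym 1≈0)

  times-inverse : ∀ y {x} → Nonzero x → y ≈ y * (x * x ⁻¹)
  times-inverse y {x} x≉0 = sym (trans (*-congˡ (⁻¹-inverseʳ x x≉0)) (*-identityʳ y))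

  cancelˡ : ∀ {k x y} → Nonzero k → k * x ≈ k * y → x ≈ y
  cancelˡ {k} {x} {y} k≉0 eq = begin
    x               ≈⟨ times-inverse x k≉0 ⟩
    x * (k * k ⁻¹)  ≈⟨ solve 3 (λ x k k⁻¹ → x :* (k :* k⁻¹) := k⁻¹ :* (k :* x)) refl x k (k ⁻¹) ⟩
    k ⁻¹ * (k * x)  ≈⟨ *-congˡ eq ⟩
    k ⁻¹ * (k * y)  ≈⟨ solve 3 (λ y k k⁻¹ → k⁻¹ :* (k :* y) := y :* (k :* k⁻¹)) refl y k (k ⁻¹) ⟩
    y * (k * k ⁻¹)  ≈⟨ sym (times-inverse y k≉0) ⟩
    y               ∎

  nonzero-* : ∀ {x y} → Nonzero x → Nonzero y → Nonzero (x * y)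
  nonzero-* {x} {y} x≉0 y≉0 xy≈0 = y≉0 (cancelˡ x≉0 (trans xy≈0 (sym (zeroʳ x))))

  nonzero-factor : ∀ {x y} → Nonzero (x * y) → Nonzero x
  nonzero-factor {x} {y} xy≉0 x≈0 = xy≉0 (trans (*-congʳ x≈0) (zeroˡ y))

  mul-div : ∀ x A B → x * (A / B) ≈ (x * A) / B
  mul-div x A B = sym (*-assoc x A (B ⁻¹))

  div-mul : ∀ A B x → (A / B) * x ≈ (A * x) / B
  div-mul A B x = solve 3 (λ A B⁻¹ x → (A :* B⁻¹) :* x := (A :* x) :* B⁻¹) refl A (B ⁻¹) x

  div-elim : ∀ {A B C} → Nonzero B → A ≈ C * B → A / B ≈ C
  div-elim {A} {B} {C} B≉0 eq = begin
    A * B ⁻¹         ≈⟨ *-congʳ eq ⟩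
    (C * B) * B ⁻¹   ≈⟨ *-assoc C B (B ⁻¹) ⟩
    C * (B * B ⁻¹)   ≈⟨ sym (times-inverse C B≉0) ⟩
    C                ∎

  cross-multiply : ∀ {A B C D} → Nonzero B → Nonzero D → A * D ≈ C * B → A / B ≈ C / D
  cross-multiply {A} {B} {C} {D} B≉0 D≉0 eq = begin
    A * B ⁻¹                  ≈⟨ times-inverse _ D≉0 ⟩
    (A * B ⁻¹) * (D * D ⁻¹)   ≈⟨ solve 4 (λ A B⁻¹ D D⁻¹ → (A :* B⁻¹) :* (D :* D⁻¹) := ((A :* D) :* B⁻¹) :* D⁻¹) refl A (B ⁻¹) D (D ⁻¹) ⟩
    ((A * D) * B ⁻¹) * D ⁻¹   ≈⟨ *-congʳ (*-congʳ eq) ⟩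
    ((C * B) * B ⁻¹) * D ⁻¹   ≈⟨ solve 4 (λ C B B⁻¹ D⁻¹ → ((C :* B) :* B⁻¹) :* D⁻¹ := (C :* D⁻¹) :* (B :* B⁻¹)) refl C B (B ⁻¹) (D ⁻¹) ⟩
    (C * D ⁻¹) * (B * B ⁻¹)   ≈⟨ sym (times-inverse _ B≉0) ⟩
    C * D ⁻¹                  ∎

  div-mul-div : ∀ {A B C D} → Nonzero B → Nonzero D → (A / B) * (C / D) ≈ (A * C) / (B * D)
  div-mul-div {A} {B} {C} {D} B≉0 D≉0 = begin
    (A * B ⁻¹) * (C * D ⁻¹)                  ≈⟨ times-inverse _ (nonzero-* B≉0 D≉0) ⟩
    (A * B ⁻¹) * (C * D ⁻¹) * ((B * D) * E)  ≈⟨ solve 7 (λ A B⁻¹ C D⁻¹ B D E →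
                                                   (A :* B⁻¹) :* (C :* D⁻¹) :* ((B :* D) :* E)
                                                   := ((A :* C) :* E) :* (B :* B⁻¹) :* (D :* D⁻¹))
                                                 refl A (B ⁻¹) C (D ⁻¹) B D E ⟩
    ((A * C) * E) * (B * B ⁻¹) * (D * D ⁻¹)  ≈⟨ sym (trans (times-inverse _ B≉0) (times-inverse _ D≉0)) ⟩
    (A * C) * E                              ∎
    where E = (B * D) ⁻¹

  -- A product of two fractions regrouped as a product of three, checked by
  -- cross-multiplication; this is how each summand is put into convolution form.
  regroup : ∀ {A B C D A′ B′ C′ D′ E′ G′} →
    Nonzero B → Nonzero D → Nonzero B′ → Nonzero D′ → Nonzero G′ →
    (A * C) * (B′ * (D′ * G′)) ≈ (A′ * (C′ * E′)) * (B * D) →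
    (A / B) * (C / D) ≈ (A′ / B′) * ((C′ / D′) * (E′ / G′))
  regroup {A} {B} {C} {D} {A′} {B′} {C′} {D′} {E′} {G′} B≉0 D≉0 B′≉0 D′≉0 G′≉0 eq = begin
    (A / B) * (C / D)                     ≈⟨ div-mul-div B≉0 D≉0 ⟩
    (A * C) / (B * D)                     ≈⟨ cross-multiply (nonzero-* B≉0 D≉0) (nonzero-* B′≉0 (nonzero-* D′≉0 G′≉0)) eq ⟩
    (A′ * (C′ * E′)) / (B′ * (D′ * G′))   ≈⟨ sym (div-mul-div B′≉0 (nonzero-* D′≉0 G′≉0)) ⟩
    (A′ / B′) * ((C′ * E′) / (D′ * G′))   ≈⟨ *-congˡ (sym (div-mul-div D′≉0 G′≉0)) ⟩
    (A′ / B′) * ((C′ / D′) * (E′ / G′))   ∎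

  drop-factor : ∀ {A B E} → Nonzero B → Nonzero E → (A / (B * E)) * E ≈ A / B
  drop-factor {A} {B} {E} B≉0 E≉0 = trans (div-mul A (B * E) E)
    (cross-multiply (nonzero-* B≉0 E≉0) B≉0 (solve 3 (λ A B E → (A :* E) :* B := A :* (B :* E)) refl A B E))

  -- A step of a contiguity relation for a quotient A / (B * E) reduces to an
  -- identity of numerators.
  quotient-step : ∀ {A B E E′ k C m} → Nonzero B → Nonzero E′ → E′ ≈ E → A ≈ k * C * m →
    (A / (B * E)) * E′ ≈ k * (C / B) * m
  quotient-step {A} {B} {E} {E′} {k} {C} {m} B≉0 E′≉0 E′≈E eq = begin
    (A / (B * E)) * E′   ≈⟨ *-congˡ E′≈E ⟩
    (A / (B * E)) * E    ≈⟨ drop-factor B≉0 (nonzero-resp (sym E′≈E) E′≉0) ⟩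
    A / B                ≈⟨ *-congʳ eq ⟩
    (k * C * m) / B      ≈⟨ solve 4 (λ k C m B⁻¹ → (k :* C :* m) :* B⁻¹ := k :* (C :* B⁻¹) :* m) refl k C m (B ⁻¹) ⟩
    k * (C / B) * m      ∎

  rescale : ∀ {A B C X Y z} → Nonzero B → Nonzero C → C * X ≈ z * (B * Y) → (A / B) * X ≈ z * ((A / C) * Y)
  rescale {A} {B} {C} {X} {Y} {z} B≉0 C≉0 eq = begin
    (A * B ⁻¹) * X                    ≈⟨ times-inverse _ C≉0 ⟩
    ((A * B ⁻¹) * X) * (C * C ⁻¹)     ≈⟨ solve 5 (λ A B⁻¹ X C C⁻¹ → ((A :* B⁻¹) :* X) :* (C :* C⁻¹) := (A :* B⁻¹ :* C⁻¹) :* (C :* X)) refl A (B ⁻¹) X C (C ⁻¹) ⟩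
    (A * B ⁻¹ * C ⁻¹) * (C * X)       ≈⟨ *-congˡ eq ⟩
    (A * B ⁻¹ * C ⁻¹) * (z * (B * Y)) ≈⟨ solve 6 (λ A B⁻¹ C⁻¹ z B Y → (A :* B⁻¹ :* C⁻¹) :* (z :* (B :* Y)) := (z :* ((A :* C⁻¹) :* Y)) :* (B :* B⁻¹)) refl A (B ⁻¹) (C ⁻¹) z B Y ⟩
    (z * ((A * C ⁻¹) * Y)) * (B * B ⁻¹) ≈⟨ sym (times-inverse _ B≉0) ⟩
    z * ((A * C ⁻¹) * Y)              ∎

  use-relation : ∀ {L R K E F} → L ≈ R + K * (E - F) → E ≈ F → L ≈ R
  use-relation {L} {R} {K} {E} {F} eq E≈F = begin
    L                ≈⟨ eq ⟩
    R + K * (E - F)  ≈⟨ +-congˡ (*-congˡ (trans (+-congʳ E≈F) (-‿inverseʳ F))) ⟩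
    R + K * 0#       ≈⟨ +-congˡ (zeroʳ K) ⟩
    R + 0#           ≈⟨ +-identityʳ R ⟩
    R                ∎

  sum1-cong : ∀ M {f g : ℕ → Carrier} → (∀ n → 1 ≤ n → n ≤ M → f n ≈ g n) → sum1 M f ≈ sum1 M g
  sum1-cong zero    f≈g = refl
  sum1-cong (suc M) f≈g = +-cong (sum1-cong M (λ n 1≤n n≤M → f≈g n 1≤n (ℕP.m≤n⇒m≤1+n n≤M)))
                                 (f≈g (suc M) (s≤s z≤n) ℕP.≤-refl)

  sum1-scale : ∀ M k (f : ℕ → Carrier) → sum1 M (λ n → k * f n) ≈ k * sum1 M f
  sum1-scale zero    k f = sym (zeroʳ k)
  sum1-scale (suc M) k f = trans (+-congʳ (sum1-scale M k f)) (sym (distribˡ k _ _))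

  sum1-sub : ∀ M (f g : ℕ → Carrier) → sum1 M (λ n → f n - g n) ≈ sum1 M f - sum1 M g
  sum1-sub zero    f g = solve 0 (con (+ 0) := con (+ 0) :- con (+ 0)) refl
  sum1-sub (suc M) f g = trans (+-congʳ (sum1-sub M f g))
    (solve 4 (λ A B x y → (A :- B) :+ (x :- y) := (A :+ x) :- (B :+ y)) refl (sum1 M f) (sum1 M g) (f (suc M)) (g (suc M)))

  telescope : ∀ M (U : ℕ → Carrier) → sum1 M (λ n → U n - U (suc n)) ≈ U 1 - U (suc M)
  telescope zero    U = sym (-‿inverseʳ (U 1))
  telescope (suc M) U = trans (+-congʳ (telescope M U))
    (solve 3 (λ a b c → (a :- b) :+ (b :- c) := a :- c) refl (U 1) (U (suc M)) (U (suc (suc M))))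

  pow-+ : ∀ x m n → x ^ (m ℕ.+ n) ≈ x ^ m * x ^ n
  pow-+ x zero    n = sym (*-identityˡ _)
  pow-+ x (suc m) n = trans (*-congˡ (pow-+ x m n)) (sym (*-assoc _ _ _))

  shifted-factor : ∀ b q m → 1# - (b * q) * q ^ m ≈ 1# - b * q ^ suc m
  shifted-factor b q m = +-congˡ (-‿cong (*-assoc b q (q ^ m)))

  poch-nonzero : ∀ A q m → (∀ k → suc k ≤ m → Nonzero (1# - A * q ^ k)) → Nonzero (poch A q m)
  poch-nonzero A q zero    factors≉0 = one-nonzero
  poch-nonzero A q (suc m) factors≉0 =
    nonzero-* (poch-nonzero A q m (λ k k<m → factors≉0 k (ℕP.m≤n⇒m≤1+n k<m))) (factors≉0 m ℕP.≤-refl)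

  -- The weight (bq;q)_m / (q;q)_m, the coefficient of x^m in (bqx;q)_∞/(x;q)_∞.
  weight : Carrier → Carrier → ℕ → Carrier
  weight q b m = poch (b * q) q m / poch q q m

  weight-step : ∀ q b m → Nonzero (poch q q (suc m)) →
    (1# - q ^ suc m) * weight q b (suc m) ≈ (1# - b * q ^ suc m) * weight q b m
  weight-step q b m pq≉0 = begin
    (1# - q * Q) * ((Bm * (1# - (b * q) * Q)) / (Pm * (1# - q * Q))) ≈⟨ mul-div _ _ _ ⟩
    ((1# - q * Q) * (Bm * (1# - (b * q) * Q))) / (Pm * (1# - q * Q))
      ≈⟨ cross-multiply pq≉0 (nonzero-factor pq≉0)
           (solve 5 (λ Q q b Bm Pm → ((𝟙 :- q :* Q) :* (Bm :* (𝟙 :- (b :* q) :* Q))) :* Pm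
              := ((𝟙 :- b :* (q :* Q)) :* Bm) :* (Pm :* (𝟙 :- q :* Q))) refl Q q b Bm Pm) ⟩
    ((1# - b * (q * Q)) * Bm) / Pm                                    ≈⟨ sym (mul-div _ _ _) ⟩
    (1# - b * (q * Q)) * (Bm / Pm)                                    ∎
    where
      Q  = q ^ m
      Bm = poch (b * q) q m
      Pm = poch q q m

  -- This is the induction step of the main argument.
  recurrence-transfer : ∀ {D E a P Q L₀ L₁ R₀ R₁ f g} → Nonzero D →
    D * (a * L₁ - E * L₀) ≈ f → D * (D * R₁ - E * R₀) ≈ g →
    P * L₀ ≈ Q * R₀ → P * f ≈ Q * g → P * a * L₁ ≈ Q * D * R₁
  recurrence-transfer {D} {E} {a} {P} {Q} {L₀} {L₁} {R₀} {R₁} {f} {g} D≉0 left right base forcing =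
    cancelˡ D≉0
      (use-relation (use-relation (use-relation (use-relation
        (solve 11 (λ D E a P Q L₀ L₁ R₀ R₁ f g →
           D :* (P :* a :* L₁)
           := D :* (Q :* D :* R₁)
              :+ P :* (D :* (a :* L₁ :- E :* L₀) :- f)
              :+ (:- Q) :* (D :* (D :* R₁ :- E :* R₀) :- g)
              :+ (D :* E) :* (P :* L₀ :- Q :* R₀)
              :+ 𝟙 :* (P :* f :- Q :* g))
          refl D E a P Q L₀ L₁ R₀ R₁ f g)
        forcing) base) right) left)

  convolution : (ℕ → Carrier) → (ℕ → Carrier) → ℕ → Carrier
  convolution α w K = sum1 K (λ n → α n * w (K ∸ n))

  convolution-cong : ∀ K {α β} w → (∀ n → 1 ≤ n → n ≤ K → α n ≈ β n) → convolution α w K ≈ convolution β w K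
  convolution-cong K w α≈β = sum1-cong K (λ n 1≤n n≤K → *-congʳ (α≈β n 1≤n n≤K))

  module ConvolutionStep (q b : Carrier) (w : ℕ → Carrier) (M : ℕ)
    (w-step : ∀ m → suc m ≤ M → (1# - q ^ suc m) * w (suc m) ≈ (1# - b * q ^ suc m) * w m) where

    X : (ℕ → Carrier) → ℕ → Carrier
    X α = convolution α w

    suc-∸ : ∀ n → n ≤ M → suc M ∸ n P.≡ suc (M ∸ n)
    suc-∸ n n≤M = ℕP.+-∸-assoc 1 n≤M

    step-index : ∀ n → 1 ≤ n → n ≤ M → suc (M ∸ n) ≤ M
    step-index (suc n) _ (s≤s n≤M) = s≤s (ℕP.m∸n≤m _ n)

    split-power : ∀ n → n ≤ M → q ^ suc M ≈ q ^ n * (q * q ^ (M ∸ n))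
    split-power n n≤M = begin
      q ^ suc M               ≡⟨ P.cong (λ k → q ^ suc k) (P.sym (ℕP.m+[n∸m]≡n n≤M)) ⟩
      q ^ suc (n ℕ.+ (M ∸ n)) ≡⟨ P.cong (q ^_) (P.sym (ℕP.+-suc n (M ∸ n))) ⟩
      q ^ (n ℕ.+ suc (M ∸ n)) ≈⟨ pow-+ q n (suc (M ∸ n)) ⟩
      q ^ n * (q * q ^ (M ∸ n)) ∎

    split-difference : ∀ α P Q → P * X α (suc M) - Q * X α M
      ≈ sum1 M (λ n → P * (α n * w (suc M ∸ n)) - Q * (α n * w (M ∸ n))) + P * (α (suc M) * w (suc M ∸ suc M))
    split-difference α P Q = begin
      P * (Y + T) - Q * X α M     ≈⟨ solve 5 (λ P Y T Q Z → P :* (Y :+ T) :- Q :* Z := (P :* Y :- Q :* Z) :+ P :* T) refl P Y T Q (X α M) ⟩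
      (P * Y - Q * X α M) + P * T ≈⟨ +-congʳ (sym (+-cong (sum1-scale M P _) (-‿cong (sum1-scale M Q _)))) ⟩
      (sum1 M (λ n → P * (α n * w (suc M ∸ n))) - sum1 M (λ n → Q * (α n * w (M ∸ n)))) + P * T
                                  ≈⟨ +-congʳ (sym (sum1-sub M _ _)) ⟩
      sum1 M (λ n → P * (α n * w (suc M ∸ n)) - Q * (α n * w (M ∸ n))) + P * T ∎
      where
        Y = sum1 M (λ n → α n * w (suc M ∸ n))
        T = α (suc M) * w (suc M ∸ suc M)

    twisted : (ℕ → Carrier) → Carrier → ℕ → Carrier
    twisted α d n = α n * (1# - d * q ^ n)

    -- The weight recurrence moves the factor 1 − d q^{M+1} onto the coefficients:
    -- (1 − d q^{M+1}) X_α(M+1) − (1 − d b q^{M+1}) X_α(M) = X_α′(M+1) − X_α′(M).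
    twist : ∀ α d → (1# - d * q ^ suc M) * X α (suc M) - (1# - d * b * q ^ suc M) * X α M
                    ≈ X (twisted α d) (suc M) - X (twisted α d) M
    twist α d = begin
      DN * X α (suc M) - DB * X α M   ≈⟨ split-difference α DN DB ⟩
      sum1 M (λ n → DN * (α n * w (suc M ∸ n)) - DB * (α n * w (M ∸ n))) + DN * T
                                      ≈⟨ +-congʳ (sum1-cong M summand) ⟩
      sum1 M (λ n → α′ n * w (suc M ∸ n) - α′ n * w (M ∸ n)) + DN * T
                                      ≈⟨ +-congʳ (sum1-sub M _ _) ⟩
      (Y′ - X α′ M) + DN * T          ≈⟨ solve 5 (λ Y′ Z DN A W → (Y′ :- Z) :+ DN :* (A :* W) := (Y′ :+ (A :* DN) :* W) :- Z) refl Y′ (X α′ M) DN (α (suc M)) (w (suc M ∸ suc M)) ⟩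
      X α′ (suc M) - X α′ M           ∎
      where
        DN = 1# - d * q ^ suc M
        DB = 1# - d * b * q ^ suc M
        α′ = twisted α d
        T  = α (suc M) * w (suc M ∸ suc M)
        Y′ = sum1 M (λ n → α′ n * w (suc M ∸ n))

        core : ∀ A W₁ W₀ Qn Qm QN → QN ≈ Qn * (q * Qm) → (1# - q * Qm) * W₁ ≈ (1# - b * (q * Qm)) * W₀ →
          (1# - d * QN) * (A * W₁) - (1# - d * b * QN) * (A * W₀) ≈ (A * (1# - d * Qn)) * W₁ - (A * (1# - d * Qn)) * W₀
        core A W₁ W₀ Qn Qm QN QN≈ step = begin
          (1# - d * QN) * (A * W₁) - (1# - d * b * QN) * (A * W₀)
            ≈⟨ +-cong (*-congʳ (+-congˡ (-‿cong (*-congˡ QN≈)))) (-‿cong (*-congʳ (+-congˡ (-‿cong (*-congˡ QN≈))))) ⟩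
          (1# - d * (Qn * (q * Qm))) * (A * W₁) - (1# - d * b * (Qn * (q * Qm))) * (A * W₀)
            ≈⟨ use-relation (solve 8 (λ A W₁ W₀ Qn Qm q d b →
                 (𝟙 :- d :* (Qn :* (q :* Qm))) :* (A :* W₁) :- (𝟙 :- d :* b :* (Qn :* (q :* Qm))) :* (A :* W₀)
                 := (A :* (𝟙 :- d :* Qn)) :* W₁ :- (A :* (𝟙 :- d :* Qn)) :* W₀
                    :+ (A :* d :* Qn) :* ((𝟙 :- q :* Qm) :* W₁ :- (𝟙 :- b :* (q :* Qm)) :* W₀))
                 refl A W₁ W₀ Qn Qm q d b) step ⟩
          (A * (1# - d * Qn)) * W₁ - (A * (1# - d * Qn)) * W₀ ∎

        summand : ∀ n → 1 ≤ n → n ≤ M →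
          DN * (α n * w (suc M ∸ n)) - DB * (α n * w (M ∸ n)) ≈ α′ n * w (suc M ∸ n) - α′ n * w (M ∸ n)
        summand n 1≤n n≤M rewrite suc-∸ n n≤M =
          core (α n) (w (suc (M ∸ n))) (w (M ∸ n)) (q ^ n) (q ^ (M ∸ n)) (q ^ suc M)
               (split-power n n≤M) (w-step (M ∸ n) (step-index n 1≤n n≤M))

    Contiguous : (ℕ → Carrier) → Carrier → Set ℓ
    Contiguous α y = ∀ k → 1 ≤ k → k ≤ M → α (suc k) * (1# - y * q ^ suc k) ≈ q * α k * (b - y * q ^ k)

    -- For contiguous α the difference of consecutive convolutions telescopes:
    -- (1 − y q^{M+1}) (X_α(M+1) − X_α(M)) = α₁ w_M q^M (1 − y q).
    difference : ∀ α y → Contiguous α y →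
      (1# - y * q ^ suc M) * (X α (suc M) - X α M) ≈ α 1 * w M * q ^ M * (1# - y * q ^ 1)
    difference α y contiguous = begin
      D * (X α (suc M) - X α M)          ≈⟨ x[y-z]≈xy-xz D _ _ ⟩
      D * X α (suc M) - D * X α M        ≈⟨ split-difference α D D ⟩
      sum1 M (λ n → D * (α n * w (suc M ∸ n)) - D * (α n * w (M ∸ n))) + D * T
                                         ≈⟨ +-cong (sum1-cong M summand) last ⟩
      sum1 M (λ n → U n - U (suc n)) + U (suc M)
                                         ≈⟨ +-congʳ (telescope M U) ⟩
      (U 1 - U (suc M)) + U (suc M)      ≈⟨ solve 2 (λ u v → (u :- v) :+ v := u) refl (U 1) (U (suc M)) ⟩
      U 1                                ∎
      where
        D = 1# - y * q ^ suc M
        T = α (suc M) * w (suc M ∸ suc M)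

        U : ℕ → Carrier
        U k = α k * w (suc M ∸ k) * q ^ (suc M ∸ k) * (1# - y * q ^ k)

        last : D * T ≈ U (suc M)
        last = begin
          D * T                        ≈⟨ solve 3 (λ D A W → D :* (A :* W) := A :* W :* 𝟙 :* D) refl D (α (suc M)) (w (M ∸ M)) ⟩
          T * 1# * D                   ≈⟨ *-congʳ (*-congˡ (reflexive (P.cong (q ^_) (P.sym (ℕP.n∸n≡0 M))))) ⟩
          U (suc M)                    ∎

        -- One summand: the weight recurrence and contiguity make it a difference U_n − U_{n+1}.
        core : ∀ A A₁ W₁ W₀ Qn Qm QN → QN ≈ Qn * (q * Qm) →
          A₁ * (1# - y * (q * Qn)) ≈ q * A * (b - y * Qn) →
          (1# - q * Qm) * W₁ ≈ (1# - b * (q * Qm)) * W₀ →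
          (1# - y * QN) * (A * W₁) - (1# - y * QN) * (A * W₀)
            ≈ A * W₁ * (q * Qm) * (1# - y * Qn) - A₁ * W₀ * Qm * (1# - y * (q * Qn))
        core A A₁ W₁ W₀ Qn Qm QN QN≈ contiguous-step weight-step′ = begin
          (1# - y * QN) * (A * W₁) - (1# - y * QN) * (A * W₀)
            ≈⟨ +-cong (*-congʳ (+-congˡ (-‿cong (*-congˡ QN≈)))) (-‿cong (*-congʳ (+-congˡ (-‿cong (*-congˡ QN≈))))) ⟩
          (1# - y * (Qn * (q * Qm))) * (A * W₁) - (1# - y * (Qn * (q * Qm))) * (A * W₀)
            ≈⟨ use-relation (use-relation (solve 9 (λ A A₁ W₁ W₀ Qn Qm q y b →
                 (𝟙 :- y :* (Qn :* (q :* Qm))) :* (A :* W₁) :- (𝟙 :- y :* (Qn :* (q :* Qm))) :* (A :* W₀)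
                 := A :* W₁ :* (q :* Qm) :* (𝟙 :- y :* Qn) :- A₁ :* W₀ :* Qm :* (𝟙 :- y :* (q :* Qn))
                    :+ A :* ((𝟙 :- q :* Qm) :* W₁ :- (𝟙 :- b :* (q :* Qm)) :* W₀)
                    :+ (W₀ :* Qm) :* (A₁ :* (𝟙 :- y :* (q :* Qn)) :- q :* A :* (b :- y :* Qn)))
                 refl A A₁ W₁ W₀ Qn Qm q y b) contiguous-step) weight-step′ ⟩
          A * W₁ * (q * Qm) * (1# - y * Qn) - A₁ * W₀ * Qm * (1# - y * (q * Qn)) ∎

        summand : ∀ n → 1 ≤ n → n ≤ M → D * (α n * w (suc M ∸ n)) - D * (α n * w (M ∸ n)) ≈ U n - U (suc n)
        summand n 1≤n n≤M rewrite suc-∸ n n≤M =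
          core (α n) (α (suc n)) (w (suc (M ∸ n))) (w (M ∸ n)) (q ^ n) (q ^ (M ∸ n)) (q ^ suc M)
               (split-power n n≤M) (contiguous n 1≤n n≤M) (w-step (M ∸ n) (step-index n 1≤n n≤M))

    -- Twisting α by 1 − d qⁿ into a contiguous β yields a second-order recurrence
    -- for X_α whose forcing term is explicit.
    recurrence : ∀ α β d y → (∀ n → 1 ≤ n → n ≤ suc M → twisted α d n ≈ β n) → Contiguous β y →
      (1# - y * q ^ suc M) * ((1# - d * q ^ suc M) * X α (suc M) - (1# - d * b * q ^ suc M) * X α M)
      ≈ β 1 * (1# - y * q ^ 1) * q ^ M * w M
    recurrence α β d y twisted≈β contiguous = begin
      D * (DN * X α (suc M) - DB * X α M)        ≈⟨ *-congˡ (twist α d) ⟩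
      D * (X (twisted α d) (suc M) - X (twisted α d) M)
        ≈⟨ *-congˡ (+-cong (convolution-cong (suc M) w twisted≈β)
                           (-‿cong (convolution-cong M w (λ n 1≤n n≤M → twisted≈β n 1≤n (ℕP.m≤n⇒m≤1+n n≤M))))) ⟩
      D * (X β (suc M) - X β M)                  ≈⟨ difference β y contiguous ⟩
      β 1 * w M * q ^ M * (1# - y * q ^ 1)       ≈⟨ solve 4 (λ B W Q E → B :* W :* Q :* E := B :* E :* Q :* W) refl (β 1) (w M) (q ^ M) (1# - y * q ^ 1) ⟩
      β 1 * (1# - y * q ^ 1) * q ^ M * w M       ∎
      where
        D  = 1# - y * q ^ suc M
        DN = 1# - d * q ^ suc M
        DB = 1# - d * b * q ^ suc M

  module Corollary (q z c : Carrier) (N : ℕ) (c≉0 : Nonzero c)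
    (factors≉0 : ∀ (k : ℕ) → 1 ≤ k → k ≤ N →
       Nonzero (1# - q ^ k) × Nonzero (1# - z * q ^ k) × Nonzero (1# - c * q ^ k)) where

    pq pz pc : ℕ → Carrier
    pq m = poch q q m
    pz m = poch (z * q) q m
    pc m = poch (c * q) q m

    z-factor≉0 : ∀ k → 1 ≤ k → k ≤ N → Nonzero (1# - z * q ^ k)
    z-factor≉0 k 1≤k k≤N = proj₁ (proj₂ (factors≉0 k 1≤k k≤N))

    c-factor≉0 : ∀ k → 1 ≤ k → k ≤ N → Nonzero (1# - c * q ^ k)
    c-factor≉0 k 1≤k k≤N = proj₂ (proj₂ (factors≉0 k 1≤k k≤N))

    shifted-poch≉0 : ∀ b → (∀ k → 1 ≤ k → k ≤ N → Nonzero (1# - b * q ^ k)) →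
      ∀ m → m ≤ N → Nonzero (poch (b * q) q m)
    shifted-poch≉0 b b-factor≉0 m m≤N = poch-nonzero (b * q) q m (λ k k<m →
      nonzero-resp (shifted-factor b q k) (b-factor≉0 (suc k) (s≤s z≤n) (ℕP.≤-trans k<m m≤N)))

    pq≉0 : ∀ m → m ≤ N → Nonzero (pq m)
    pq≉0 m m≤N = poch-nonzero q q m (λ k k<m → proj₁ (factors≉0 (suc k) (s≤s z≤n) (ℕP.≤-trans k<m m≤N)))

    pz≉0 : ∀ m → m ≤ N → Nonzero (pz m)
    pz≉0 = shifted-poch≉0 z z-factor≉0

    pc≉0 : ∀ m → m ≤ N → Nonzero (pc m)
    pc≉0 = shifted-poch≉0 c c-factor≉0

    h g : ℕ → Carrier
    h = weight q z
    g = weight q c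

    weight-step≤N : ∀ b M → M ≤ N → ∀ m → suc m ≤ M →
      (1# - q ^ suc m) * weight q b (suc m) ≈ (1# - b * q ^ suc m) * weight q b m
    weight-step≤N b M M≤N m m<M = weight-step q b m (pq≉0 (suc m) (ℕP.≤-trans m<M M≤N))

    -- Coefficient sequences: the n-th summands of the two sides, stripped of
    -- the weights, are t_n = s_n / (1 − c qⁿ) and u_n = v_n / (1 − z qⁿ).
    left-numerator right-numerator : ℕ → Carrier
    left-numerator n  = pq (n ∸ 1) * (z * q) ^ n
    right-numerator n = poch (z * q / c) q (n ∸ 1) * c ^ (n ∸ 1) * q ^ n

    s t v u : ℕ → Carrier
    s n = left-numerator n / pz n
    t n = left-numerator n / (pz n * (1# - c * q ^ n))
    v n = right-numerator n / pz n
    u n = right-numerator n / (pz n * (1# - z * q ^ n))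

    t-twisted : ∀ n → 1 ≤ n → n ≤ N → t n * (1# - c * q ^ n) ≈ s n
    t-twisted n 1≤n n≤N = drop-factor (pz≉0 n n≤N) (c-factor≉0 n 1≤n n≤N)

    u-twisted : ∀ n → 1 ≤ n → n ≤ N → u n * (1# - z * q ^ n) ≈ v n
    u-twisted n 1≤n n≤N = drop-factor (pz≉0 n n≤N) (z-factor≉0 n 1≤n n≤N)

    s-contiguous : ∀ k → 1 ≤ k → suc k ≤ N → s (suc k) * (1# - z * q ^ suc k) ≈ q * s k * (z - z * q ^ k)
    s-contiguous (suc j) _ j+2≤N =
      quotient-step (pz≉0 (suc j) (ℕP.<⇒≤ j+2≤N)) (z-factor≉0 (suc (suc j)) (s≤s z≤n) j+2≤N)
        (sym (shifted-factor z q (suc j)))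
        (solve 5 (λ Pj q Qj z Z → (Pj :* (𝟙 :- q :* Qj)) :* ((z :* q) :* Z) := q :* (Pj :* Z) :* (z :- z :* (q :* Qj)))
           refl (pq j) q (q ^ j) z ((z * q) ^ suc j))

    v-contiguous : ∀ k → 1 ≤ k → suc k ≤ N → v (suc k) * (1# - z * q ^ suc k) ≈ q * v k * (c - z * q ^ k)
    v-contiguous (suc j) _ j+2≤N =
      quotient-step (pz≉0 (suc j) (ℕP.<⇒≤ j+2≤N)) (z-factor≉0 (suc (suc j)) (s≤s z≤n) j+2≤N)
        (sym (shifted-factor z q (suc j)))
        (use-relation
          (solve 7 (λ Ej Cj Qj c c⁻¹ q z →
             (Ej :* (𝟙 :- (z :* q :* c⁻¹) :* Qj)) :* (c :* Cj) :* (q :* (q :* Qj))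
             := q :* (Ej :* Cj :* (q :* Qj)) :* (c :- z :* (q :* Qj))
                :+ (Ej :* Cj :* q :* (q :* Qj) :* (z :* q :* Qj)) :* (𝟙 :- c :* c⁻¹))
            refl (poch (z * q / c) q j) (c ^ j) (q ^ j) c (c ⁻¹) q z)
          (sym (⁻¹-inverseʳ c c≉0)))

    s-initial : 1 ≤ N → s 1 * (1# - z * q ^ 1) ≈ z * q
    s-initial 1≤N = trans (div-mul _ _ _) (div-elim (pz≉0 1 1≤N)
      (solve 2 (λ z q → (𝟙 :* ((z :* q) :* 𝟙)) :* (𝟙 :- z :* (q :* 𝟙)) := (z :* q) :* (𝟙 :* (𝟙 :- (z :* q) :* 𝟙))) refl z q))

    v-initial : 1 ≤ N → v 1 * (1# - z * q ^ 1) ≈ q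
    v-initial 1≤N = trans (div-mul _ _ _) (div-elim (pz≉0 1 1≤N)
      (solve 2 (λ z q → ((𝟙 :* 𝟙) :* (q :* 𝟙)) :* (𝟙 :- z :* (q :* 𝟙)) := q :* (𝟙 :* (𝟙 :- (z :* q) :* 𝟙))) refl z q))

    left-sum right-sum : ℕ → Carrier
    left-sum  = convolution t h
    right-sum = convolution u g

    left-recurrence : ∀ M → suc M ≤ N →
      (1# - z * q ^ suc M) * ((1# - c * q ^ suc M) * left-sum (suc M) - (1# - c * z * q ^ suc M) * left-sum M)
      ≈ z * q * q ^ M * h M
    left-recurrence M M<N = trans
      (recurrence t s c z (λ n 1≤n n≤M+1 → t-twisted n 1≤n (ℕP.≤-trans n≤M+1 M<N))
                  (λ k 1≤k k≤M → s-contiguous k 1≤k (ℕP.≤-trans (s≤s k≤M) M<N)))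
      (*-congʳ (*-congʳ (s-initial (ℕP.≤-trans (s≤s z≤n) M<N))))
      where open ConvolutionStep q z h M (weight-step≤N z M (ℕP.<⇒≤ M<N))

    right-recurrence : ∀ M → suc M ≤ N →
      (1# - z * q ^ suc M) * ((1# - z * q ^ suc M) * right-sum (suc M) - (1# - c * z * q ^ suc M) * right-sum M)
      ≈ q * q ^ M * g M
    right-recurrence M M<N = trans
      (*-congˡ (+-congˡ (-‿cong (*-congʳ (+-congˡ (-‿cong (*-congʳ (*-comm c z))))))))
      (trans
        (recurrence u v z z (λ n 1≤n n≤M+1 → u-twisted n 1≤n (ℕP.≤-trans n≤M+1 M<N))
                    (λ k 1≤k k≤M → v-contiguous k 1≤k (ℕP.≤-trans (s≤s k≤M) M<N)))
        (*-congʳ (*-congʳ (v-initial (ℕP.≤-trans (s≤s z≤n) M<N)))))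
      where open ConvolutionStep q c g M (weight-step≤N c M (ℕP.<⇒≤ M<N))

    convolutions-related : ∀ K → K ≤ N → pc K * left-sum K ≈ z * (pz K * right-sum K)
    convolutions-related zero    _   = solve 1 (λ z → 𝟙 :* con (+ 0) := z :* (𝟙 :* con (+ 0))) refl z
    convolutions-related (suc M) M<N = begin
      pc M * (1# - (c * q) * q ^ M) * left-sum (suc M)        ≈⟨ *-congʳ (*-congˡ (shifted-factor c q M)) ⟩
      pc M * (1# - c * q ^ suc M) * left-sum (suc M)
        ≈⟨ recurrence-transfer (z-factor≉0 (suc M) (s≤s z≤n) M<N) (left-recurrence M M<N) (right-recurrence M M<N)
             (trans (convolutions-related M (ℕP.<⇒≤ M<N)) (sym (*-assoc z (pz M) (right-sum M)))) forcing ⟩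
      z * pz M * (1# - z * q ^ suc M) * right-sum (suc M)     ≈⟨ *-congʳ (*-congˡ (sym (shifted-factor z q M))) ⟩
      z * pz M * (1# - (z * q) * q ^ M) * right-sum (suc M)   ≈⟨ solve 4 (λ z P E R → z :* P :* E :* R := z :* ((P :* E) :* R)) refl z (pz M) (1# - (z * q) * q ^ M) (right-sum (suc M)) ⟩
      z * (pz (suc M) * right-sum (suc M))                    ∎
      where
        -- (cq;q)_M h_M = (zq;q)_M g_M, both being (cq;q)_M (zq;q)_M / (q;q)_M.
        forcing : pc M * (z * q * q ^ M * h M) ≈ z * pz M * (q * q ^ M * g M)
        forcing = solve 6 (λ C X z q Q P⁻¹ → C :* (z :* q :* Q :* (X :* P⁻¹)) := z :* X :* (q :* Q :* (C :* P⁻¹)))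
                    refl (pc M) (pz M) z q (q ^ M) (pq M ⁻¹)

    left-summand : ∀ n → 1 ≤ n → n ≤ N →
      qbinom q N n * ((pq (n ∸ 1) * pq n * pz (N ∸ n) * (z * q) ^ n) / (pz n * pz N * (1# - c * q ^ n)))
      ≈ (pq N / pz N) * (t n * h (N ∸ n))
    left-summand n 1≤n n≤N =
      regroup (nonzero-* (pq≉0 n n≤N) (pq≉0 (N ∸ n) (ℕP.m∸n≤m N n)))
              (nonzero-* (nonzero-* (pz≉0 n n≤N) (pz≉0 N ℕP.≤-refl)) (c-factor≉0 n 1≤n n≤N))
              (pz≉0 N ℕP.≤-refl) (nonzero-* (pz≉0 n n≤N) (c-factor≉0 n 1≤n n≤N)) (pq≉0 (N ∸ n) (ℕP.m∸n≤m N n))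
        (solve 9 (λ PN P′ Pn Xr xn Xn XN Cn Pr →
           (PN :* (((P′ :* Pn) :* Xr) :* xn)) :* (XN :* ((Xn :* Cn) :* Pr))
           := (PN :* ((P′ :* xn) :* Xr)) :* ((Pn :* Pr) :* ((Xn :* XN) :* Cn)))
          refl (pq N) (pq (n ∸ 1)) (pq n) (pz (N ∸ n)) ((z * q) ^ n) (pz n) (pz N) (1# - c * q ^ n) (pq (N ∸ n)))

    right-summand : ∀ n → 1 ≤ n → n ≤ N →
      qbinom q N n * ((poch (z * q / c) q (n ∸ 1) * pq n * pc (N ∸ n) * c ^ (n ∸ 1) * q ^ n)
                      / (pz n * pc N * (1# - z * q ^ n)))
      ≈ (pq N / pc N) * (u n * g (N ∸ n))
    right-summand n 1≤n n≤N =
      regroup (nonzero-* (pq≉0 n n≤N) (pq≉0 (N ∸ n) (ℕP.m∸n≤m N n)))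
              (nonzero-* (nonzero-* (pz≉0 n n≤N) (pc≉0 N ℕP.≤-refl)) (z-factor≉0 n 1≤n n≤N))
              (pc≉0 N ℕP.≤-refl) (nonzero-* (pz≉0 n n≤N) (z-factor≉0 n 1≤n n≤N)) (pq≉0 (N ∸ n) (ℕP.m∸n≤m N n))
        (solve 10 (λ PN E Pn Cr cp qn Xn CN Zn Pr →
           (PN :* ((((E :* Pn) :* Cr) :* cp) :* qn)) :* (CN :* ((Xn :* Zn) :* Pr))
           := (PN :* (((E :* cp) :* qn) :* Cr)) :* ((Pn :* Pr) :* ((Xn :* CN) :* Zn)))
          refl (pq N) (poch (z * q / c) q (n ∸ 1)) (pq n) (pc (N ∸ n)) (c ^ (n ∸ 1)) (q ^ n)
               (pz n) (pc N) (1# - z * q ^ n) (pq (N ∸ n)))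

    left-side : sum1 N (λ n → qbinom q N n
                  * ((pq (n ∸ 1) * pq n * pz (N ∸ n) * (z * q) ^ n) / (pz n * pz N * (1# - c * q ^ n))))
                ≈ (pq N / pz N) * left-sum N
    left-side = trans (sum1-cong N left-summand) (sum1-scale N _ _)

    right-side : sum1 N (λ n → qbinom q N n
                   * ((poch (z * q / c) q (n ∸ 1) * pq n * pc (N ∸ n) * c ^ (n ∸ 1) * q ^ n)
                      / (pz n * pc N * (1# - z * q ^ n))))
                 ≈ (pq N / pc N) * right-sum N
    right-side = trans (sum1-cong N right-summand) (sum1-scale N _ _)

corollary4p4 : {a ℓ : Level} (F : Field a ℓ) →
    let open Field F
        open FieldDefs F
    in (q z c : Carrier) (N : ℕ) →
       ¬ (c ≈ 0#) →
       (∀ (k : ℕ) → 1 ≤ k → k ≤ N →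
          ¬ (1# - q ^ k ≈ 0#) × ¬ (1# - z * q ^ k ≈ 0#) × ¬ (1# - c * q ^ k ≈ 0#)) →
       sum1 N (λ n → qbinom q N n
                     * ((poch q q (n ∸ 1) * poch q q n * poch (z * q) q (N ∸ n) * (z * q) ^ n)
                        / (poch (z * q) q n * poch (z * q) q N * (1# - c * q ^ n))))
       ≈ z * sum1 N (λ n → qbinom q N n
                     * ((poch (z * q / c) q (n ∸ 1) * poch q q n * poch (c * q) q (N ∸ n)
                         * c ^ (n ∸ 1) * q ^ n)
                        / (poch (z * q) q n * poch (c * q) q N * (1# - z * q ^ n))))
corollary4p4 F q z c N c≉0 factors≉0 = begin
    _                                 ≈⟨ left-side ⟩
    (pq N / pz N) * left-sum N        ≈⟨ rescale (pz≉0 N ℕP.≤-refl) (pc≉0 N ℕP.≤-refl) (convolutions-related N ℕP.≤-refl) ⟩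
    z * ((pq N / pc N) * right-sum N) ≈⟨ *-congˡ (sym right-side) ⟩
    _                                 ∎
  where
    open Field F
    open FieldDefs F
    open FieldFacts F
    open Corollary q z c N c≉0 factors≉0
    open import Relation.Binary.Reasoning.Setoid setoid
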